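{- Let $n\ge1$, $j\in\{0,\dots,n\}$ and $i\in[n]$. Then: (1) if $j\le i-1$, then $\{\mathcal{S}(c_{i,n},k,2^j):k\in[2^n]\}=\{0,1,\dots,2^j\}$; (2) if $j\ge i$, then $\mathcal{S}(c_{i,n},k,2^j)=2^{j-1}$ for every $k\in[2^n]$.
   Context: For $m\ge0$ and $i\ge1$, $\mathrm{bin}(m,i)$ is the $i$-th bit of $m$ counted from the least significant bit. For $i\in[n]$, $c_{i,n}$ is the $0$-$1$ list of length $2^n$ with $c_{i,n}(j)=\mathrm{bin}(j-1,i)$. For a list $L$ of length $M$, $k\in[M]$ and $N\ge1$, $\mathcal{S}(L,k,N)=\sum_{t=0}^{N-1}L\big(1+((k+t-1)\bmod M)\big)$ is the cyclic contiguous sum of $N$ entries starting at index $k$. -}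

module Defs where

open import Data.Nat using (ℕ; zero; suc; _+_; _∸_; _^_; NonZero)
open import Data.Nat.DivMod using (_/_; _%_)
open import Data.List using (List; []; _∷_; map; length; upTo)
open import Data.Nat.ListAction using (sum)

bin : ℕ → ℕ → ℕ
bin m zero = 0            -- bit 0 is undefined in the paper; never used (i ≥ 1)
bin m (suc zero) = m % 2
bin m (suc (suc i)) = bin (m / 2) (suc i)

-- 1-indexed list access; returns 0 outside [1, length L] (never used there).
at : List ℕ → ℕ → ℕ
at [] _ = 0
at (x ∷ xs) zero = 0
at (x ∷ xs) (suc zero) = x
at (x ∷ xs) (suc (suc j)) = at xs (suc j)

-- c i n : list of length 2^n with c i n (j) = bin (j - 1) i  for j ∈ [2^n]
c : ℕ → ℕ → List ℕ
c i n = map (λ m → bin m i) (upTo (2 ^ n))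

-- S L k N = Σ_{t=0}^{N-1} L(1 + ((k + t - 1) mod M)),  M = length L (M ≥ 1 assumed)
S : List ℕ → ℕ → ℕ → ℕ
S L k N = sum (map (λ t → at L (suc (mod (k + t ∸ 1) (length L)))) (upTo N))
  where
  mod : ℕ → ℕ → ℕ
  mod a zero = a
  mod a (suc M) = a % suc M

module Submission where

-- Write i = e + 1 and b = 2^e.  The list c_{i,n} samples
-- the bit function  bit e x = ⌊x / b⌋ mod 2,  which is periodic with period
-- 2b = 2^i, hence also with period 2^n, the length of the list.  So every
-- cyclic sum S(c_{i,n}, a + 1, N) is the plain "window sum"
-- bit e a + bit e (a + 1) + ... + bit e (a + N - 1).
--   * Window sums of a p-periodic function over p consecutive arguments do not
--     depend on the starting point, so a window of length m·p sums to m times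
--     the sum over one period; for bit e one period sums to b.  This gives (2):
--     a window of length 2^j with j ≥ i sums to 2^(j-i)·2^(i-1) = 2^(j-1).
--   * bit e is 0 on [0, b) and 1 on [b, 2b), so a window of length w + v
--     starting at b - w (with w, v ≤ b) sums to exactly v.  Together with the
--     bound bit e ≤ 1 this gives (1).
-- The file develops finite sums and windows, periodic functions, the bit
-- function and cyclic sums of sampled lists, and then proves the two parts.

open import Defs
open import Data.Nat using (ℕ; zero; suc; _+_; _*_; _∸_; _^_; _≤_; _<_; NonZero; z≤n; s≤s)
open import Data.Nat.Properties
open import Data.Nat.DivMod
open import Data.Nat.Divisibility using (divides-refl)
open import Data.Nat.ListAction using (sum)
open import Data.List using (List; _∷_; map; length; upTo; applyUpTo)
open import Data.List.Properties using (length-map; length-upTo)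
open import Data.Product using (_×_; _,_; ∃-syntax)
open import Relation.Binary.PropositionalEquality
  using (_≡_; refl; sym; trans; cong; cong₂; subst; module ≡-Reasoning)
open import Function using (_∘_)

open ≡-Reasoning

2^-split : ∀ m n → 2 ^ (m + n) ≡ 2 ^ n * 2 ^ m
2^-split m n = trans (^-distribˡ-+-* 2 m n) (*-comm (2 ^ m) (2 ^ n))

Σ : (ℕ → ℕ) → ℕ → ℕ
Σ f zero    = 0
Σ f (suc N) = f 0 + Σ (f ∘ suc) N

Σ-cong : ∀ {f h : ℕ → ℕ} N → (∀ t → t < N → f t ≡ h t) → Σ f N ≡ Σ h N
Σ-cong zero    eq = refl
Σ-cong (suc N) eq = cong₂ _+_ (eq 0 (s≤s z≤n)) (Σ-cong N (λ t t<N → eq (suc t) (s≤s t<N)))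

Σ-split : ∀ (f : ℕ → ℕ) m n → Σ f (m + n) ≡ Σ f m + Σ (λ t → f (m + t)) n
Σ-split f zero    n = refl
Σ-split f (suc m) n = trans (cong (f 0 +_) (Σ-split (f ∘ suc) m n)) (sym (+-assoc (f 0) _ _))

Σ-snoc : ∀ (f : ℕ → ℕ) N → Σ f (suc N) ≡ Σ f N + f N
Σ-snoc f zero    = +-comm (f 0) 0
Σ-snoc f (suc N) = trans (cong (f 0 +_) (Σ-snoc (f ∘ suc) N)) (sym (+-assoc (f 0) _ _))

Σ-const : ∀ c N → Σ (λ _ → c) N ≡ N * c
Σ-const c zero    = refl
Σ-const c (suc N) = cong (c +_) (Σ-const c N)

Σ-bounded : ∀ {f : ℕ → ℕ} {c} N → (∀ t → f t ≤ c) → Σ f N ≤ N * c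
Σ-bounded zero    bound = z≤n
Σ-bounded (suc N) bound = +-mono-≤ (bound 0) (Σ-bounded N (bound ∘ suc))

window : (ℕ → ℕ) → ℕ → ℕ → ℕ
window f a N = Σ (λ t → f (a + t)) N

window-split : ∀ f a m n → window f a (m + n) ≡ window f a m + window f (a + m) n
window-split f a m n =
  trans (Σ-split (λ t → f (a + t)) m n)
        (cong (window f a m +_) (Σ-cong n (λ t _ → cong f (sym (+-assoc a m t)))))

window-const : ∀ {f c} a N → (∀ t → t < N → f (a + t) ≡ c) → window f a N ≡ N * c
window-const {c = c} a N eq = trans (Σ-cong N eq) (Σ-const c N)

window-first : ∀ f a N → window f a (suc N) ≡ f a + window f (suc a) N
window-first f a N =
  cong₂ _+_ (cong f (+-identityʳ a)) (Σ-cong N (λ t _ → cong f (+-suc a t)))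

window-last : ∀ f a N → window f a (suc N) ≡ window f a N + f (a + N)
window-last f a N = Σ-snoc (λ t → f (a + t)) N

Periodic : ℕ → (ℕ → ℕ) → Set
Periodic p f = ∀ x → f (x + p) ≡ f x

periodic-multiple : ∀ {p f} → Periodic p f → ∀ m → Periodic (m * p) f
periodic-multiple {f = f} per zero    x = cong f (+-identityʳ x)
periodic-multiple {p} {f} per (suc m) x = begin
  f (x + (p + m * p))  ≡⟨ cong f (sym (+-assoc x p (m * p))) ⟩
  f (x + p + m * p)    ≡⟨ periodic-multiple per m (x + p) ⟩
  f (x + p)            ≡⟨ per x ⟩
  f x                  ∎

periodic-mod : ∀ {p f} .{{_ : NonZero p}} → Periodic p f → ∀ x → f (x % p) ≡ f x
periodic-mod {p} {f} per x = begin
  f (x % p)                  ≡⟨ sym (periodic-multiple per (x / p) (x % p)) ⟩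
  f (x % p + x / p * p)      ≡⟨ cong f (sym (m≡m%n+[m/n]*n x p)) ⟩
  f x                        ∎

-- Shifting a window of length one period by one step does not change its sum:
-- the term f a that leaves equals the term f (a + p) that enters.
window-rotate : ∀ {p f} → Periodic p f → ∀ a → window f (suc a) p ≡ window f a p
window-rotate {p} {f} per a = +-cancelˡ-≡ (f a) _ _ (begin
  f a + window f (suc a) p   ≡⟨ sym (window-first f a p) ⟩
  window f a (suc p)         ≡⟨ window-last f a p ⟩
  window f a p + f (a + p)   ≡⟨ cong (window f a p +_) (per a) ⟩
  window f a p + f a         ≡⟨ +-comm (window f a p) (f a) ⟩
  f a + window f a p         ∎)

window-period : ∀ {p f} → Periodic p f → ∀ a → window f a p ≡ window f 0 p
window-period per zero    = refl
window-period per (suc a) = trans (window-rotate per a) (window-period per a)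

window-multiple : ∀ {p f} → Periodic p f → ∀ m a → window f a (m * p) ≡ m * window f 0 p
window-multiple         per zero    a = refl
window-multiple {p} {f} per (suc m) a = begin
  window f a (p + m * p)                      ≡⟨ window-split f a p (m * p) ⟩
  window f a p + window f (a + p) (m * p)     ≡⟨ cong₂ _+_ (window-period per a)
                                                           (window-multiple per m (a + p)) ⟩
  window f 0 p + m * window f 0 p             ∎

module _ (e : ℕ) where
  private
    instance
      2^e≢0 : NonZero (2 ^ e)
      2^e≢0 = m^n≢0 2 e

  bit : ℕ → ℕ
  bit x = x / 2 ^ e % 2

  bit≤1 : ∀ x → bit x ≤ 1
  bit≤1 x = ≤-pred (m%n<n (x / 2 ^ e) 2)

  -- Adding 2^(e+1) adds 2 to ⌊x / 2^e⌋, which does not change its parity.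
  bit-periodic : Periodic (2 ^ suc e) bit
  bit-periodic x = begin
    (x + 2 * b) / b % 2         ≡⟨ cong (_% 2) (+-distrib-/-∣ʳ x (divides-refl 2)) ⟩
    (x / b + 2 * b / b) % 2     ≡⟨ cong (λ q → (x / b + q) % 2) (m*n/n≡m 2 b) ⟩
    (x / b + 1 * 2) % 2         ≡⟨ [m+kn]%n≡m%n (x / b) 1 2 ⟩
    x / b % 2                   ∎
    where b = 2 ^ e

  bit-low : ∀ {t} → t < 2 ^ e → bit t ≡ 0
  bit-low t<b = cong (_% 2) (m<n⇒m/n≡0 t<b)

  bit-high : ∀ {t} → t < 2 ^ e → bit (2 ^ e + t) ≡ 1
  bit-high {t} t<b = cong (_% 2) (begin
    (b + t) / b           ≡⟨ m/n≡1+[m∸n]/n (m≤m+n b t) ⟩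
    suc ((b + t ∸ b) / b) ≡⟨ cong (λ s → suc (s / b)) (m+n∸m≡n b t) ⟩
    suc (t / b)           ≡⟨ cong suc (m<n⇒m/n≡0 t<b) ⟩
    1                     ∎)
    where b = 2 ^ e

bin-bit : ∀ e x → bin x (suc e) ≡ bit e x
bin-bit zero    x = cong (_% 2) (sym (n/1≡n x))
bin-bit (suc e) x = trans (bin-bit e (x / 2))
  (cong (_% 2) (m/n/o≡m/[n*o] x 2 (2 ^ e) {{_}} {{m^n≢0 2 e}} {{m^n≢0 2 (suc e)}}))

window-across-jump : ∀ e {w v} → w ≤ 2 ^ e → v ≤ 2 ^ e →
                     window (bit e) (2 ^ e ∸ w) (w + v) ≡ v
window-across-jump e {w} {v} w≤b v≤b = begin
  window (bit e) a (w + v)                       ≡⟨ window-split (bit e) a w v ⟩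
  window (bit e) a w + window (bit e) (a + w) v  ≡⟨ cong₂ _+_ zeros
                                                    (cong (λ s → window (bit e) s v) a+w≡b) ⟩
  0 + window (bit e) b v                         ≡⟨ ones ⟩
  v                                              ∎
  where
  b = 2 ^ e
  a = b ∸ w
  a+w≡b : a + w ≡ b
  a+w≡b = m∸n+n≡m w≤b
  zeros : window (bit e) a w ≡ 0
  zeros = trans (window-const {bit e} a w (λ t t<w →
                   bit-low e (subst (a + t <_) a+w≡b (+-monoʳ-< a t<w))))
                (*-zeroʳ w)
  ones : window (bit e) b v ≡ v
  ones = trans (window-const {bit e} b v (λ t t<v → bit-high e (<-≤-trans t<v v≤b)))
               (*-identityʳ v)

bit-period-sum : ∀ e → window (bit e) 0 (2 ^ suc e) ≡ 2 ^ e
bit-period-sum e = begin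
  window (bit e) 0 (b + (b + 0))   ≡⟨ cong₂ (window (bit e)) (sym (n∸n≡0 b))
                                             (cong (b +_) (+-identityʳ b)) ⟩
  window (bit e) (b ∸ b) (b + b)   ≡⟨ window-across-jump e ≤-refl ≤-refl ⟩
  b                                ∎
  where b = 2 ^ e

sum-map-applyUpTo : ∀ (g f : ℕ → ℕ) N → sum (map g (applyUpTo f N)) ≡ Σ (g ∘ f) N
sum-map-applyUpTo g f zero    = refl
sum-map-applyUpTo g f (suc N) = cong (g (f 0) +_) (sum-map-applyUpTo g (f ∘ suc) N)

at-map-applyUpTo : ∀ (h f : ℕ → ℕ) {N} p → p < N → at (map h (applyUpTo f N)) (suc p) ≡ h (f p)
at-map-applyUpTo h f zero    (s≤s _)   = refl
at-map-applyUpTo h f (suc p) (s≤s p<N) = at-map-applyUpTo h (f ∘ suc) p p<N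

cyclic-sum-window : ∀ (L : List ℕ) (h : ℕ → ℕ) → 0 < length L → Periodic (length L) h →
                    (∀ x → x < length L → at L (suc x) ≡ h x) →
                    ∀ a N → S L (suc a) N ≡ window h a N
cyclic-sum-window (x ∷ xs) h _ per samples a N =
  trans (sum-map-applyUpTo (λ t → at (x ∷ xs) (suc ((a + t) % M))) (λ t → t) N)
        (Σ-cong N (λ t _ → trans (samples ((a + t) % M) (m%n<n (a + t) M))
                                 (periodic-mod per (a + t))))
  where M = suc (length xs)

cyclic-sum-c : ∀ e e' a N → S (c (suc e) (suc e + e')) (suc a) N ≡ window (bit e) a N
cyclic-sum-c e e' a N =
  cyclic-sum-window L (bit e) (subst (0 <_) (sym length-L) (m^n>0 2 n)) periodic samples a N
  where
  n = suc e + e'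
  L = c (suc e) n
  length-L : length L ≡ 2 ^ n
  length-L = trans (length-map (λ m → bin m (suc e)) (upTo (2 ^ n))) (length-upTo (2 ^ n))
  periodic : Periodic (length L) (bit e)
  periodic = subst (λ p → Periodic p (bit e)) (sym (trans length-L (2^-split (suc e) e')))
                   (periodic-multiple (bit-periodic e) (2 ^ e'))
  samples : ∀ x → x < length L → at L (suc x) ≡ bit e x
  samples x x<len = trans (at-map-applyUpTo (λ m → bin m (suc e)) (λ m → m) x
                                            (subst (x <_) length-L x<len))
                          (bin-bit e x)

cyclic-sum-≤ : ∀ e e' j k → 1 ≤ k → S (c (suc e) (suc e + e')) k (2 ^ j) ≤ 2 ^ j
cyclic-sum-≤ e e' j (suc a) _ =
  subst (_≤ 2 ^ j) (sym (cyclic-sum-c e e' a (2 ^ j)))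
        (subst (window (bit e) a (2 ^ j) ≤_) (*-identityʳ (2 ^ j))
               (Σ-bounded (2 ^ j) (λ t → bit≤1 e (a + t))))

-- (1), every value 0 ≤ v ≤ 2^j is attained when j ≤ e: start 2^j - v
-- positions before the jump of bit e at 2^e.
cyclic-sum-attains : ∀ e e' j → j ≤ e → ∀ v → v ≤ 2 ^ j →
  ∃[ k ] (1 ≤ k × k ≤ 2 ^ (suc e + e') × S (c (suc e) (suc e + e')) k (2 ^ j) ≡ v)
cyclic-sum-attains e e' j j≤e v v≤2^j = suc a , s≤s z≤n , k≤2^n , (begin
  S (c (suc e) (suc e + e')) (suc a) (2 ^ j)   ≡⟨ cyclic-sum-c e e' a (2 ^ j) ⟩
  window (bit e) a (2 ^ j)                     ≡⟨ cong (window (bit e) a) (sym (m∸n+n≡m v≤2^j)) ⟩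
  window (bit e) a (w + v)                     ≡⟨ window-across-jump e (≤-trans (m∸n≤m (2 ^ j) v) 2^j≤b)
                                                                      (≤-trans v≤2^j 2^j≤b) ⟩
  v                                            ∎)
  where
  b = 2 ^ e
  w = 2 ^ j ∸ v
  a = b ∸ w
  2^j≤b : 2 ^ j ≤ b
  2^j≤b = ^-monoʳ-≤ 2 j≤e
  k≤2^n : suc a ≤ 2 ^ (suc e + e')
  k≤2^n = ≤-trans (s≤s (m∸n≤m b w)) (^-monoʳ-< 2 (s≤s (s≤s z≤n)) (s≤s (m≤m+n e e')))

-- (2): a window of length 2^(e+1+f) covers 2^f full periods of bit e.
cyclic-sum-balanced : ∀ e e' f k → 1 ≤ k →
  S (c (suc e) (suc e + e')) k (2 ^ (suc e + f)) ≡ 2 ^ (e + f)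
cyclic-sum-balanced e e' f (suc a) _ = begin
  S (c (suc e) (suc e + e')) (suc a) (2 ^ (suc e + f))  ≡⟨ cyclic-sum-c e e' a (2 ^ (suc e + f)) ⟩
  window (bit e) a (2 ^ (suc e + f))                    ≡⟨ cong (window (bit e) a) (2^-split (suc e) f) ⟩
  window (bit e) a (2 ^ f * 2 ^ suc e)                  ≡⟨ window-multiple (bit-periodic e) (2 ^ f) a ⟩
  2 ^ f * window (bit e) 0 (2 ^ suc e)                  ≡⟨ cong (2 ^ f *_) (bit-period-sum e) ⟩
  2 ^ f * 2 ^ e                                         ≡⟨ sym (2^-split e f) ⟩
  2 ^ (e + f)                                           ∎

lemma13 : (n j i : ℕ) → 1 ≤ n → j ≤ n → 1 ≤ i → i ≤ n →
    ((suc j ≤ i) →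
      ((k : ℕ) → 1 ≤ k → k ≤ 2 ^ n → S (c i n) k (2 ^ j) ≤ 2 ^ j)
      × ((v : ℕ) → v ≤ 2 ^ j → ∃[ k ] (1 ≤ k × k ≤ 2 ^ n × S (c i n) k (2 ^ j) ≡ v)))
    × ((i ≤ j) →
      (k : ℕ) → 1 ≤ k → k ≤ 2 ^ n → S (c i n) k (2 ^ j) ≡ 2 ^ (j ∸ 1))
lemma13 n j (suc e) _ _ _ i≤n with m≤n⇒∃[o]m+o≡n i≤n
... | e' , refl = part1 , part2
  where
  part1 : suc j ≤ suc e →
          ((k : ℕ) → 1 ≤ k → k ≤ 2 ^ (suc e + e') → S (c (suc e) (suc e + e')) k (2 ^ j) ≤ 2 ^ j)
          × ((v : ℕ) → v ≤ 2 ^ j → ∃[ k ] (1 ≤ k × k ≤ 2 ^ (suc e + e') ×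
                                            S (c (suc e) (suc e + e')) k (2 ^ j) ≡ v))
  part1 (s≤s j≤e) = (λ k 1≤k _ → cyclic-sum-≤ e e' j k 1≤k) , cyclic-sum-attains e e' j j≤e

  part2 : suc e ≤ j → (k : ℕ) → 1 ≤ k → k ≤ 2 ^ (suc e + e') →
          S (c (suc e) (suc e + e')) k (2 ^ j) ≡ 2 ^ (j ∸ 1)
  part2 i≤j k 1≤k _ with m≤n⇒∃[o]m+o≡n i≤j
  ... | f , refl = cyclic-sum-balanced e e' f k 1≤k
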